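{- Let $P$ and $P'$ be posets, with $P$ uniquely realizable, let $B_P$ be a bichain with $o(B_P)=P$ and let $B_{P'}$ be a bichain with $o(B_{P'})=P'$. Then $P$ embeds into $P'$ if and only if $B_P$ embeds into $B_{P'}$ or into $B^t_{P'}$.
   Context: A bichain is $B=(V,(\le_1,\le_2))$ with $\le_1,\le_2$ linear orders on $V$; $o(B):=(V,\le_1\cap\le_2)$; $B^t:=(V,(\le_2,\le_1))$. A realizer of a poset $P=(V,\le)$ is a set of linear orders on $V$ whose intersection is $\le$. $P$ is uniquely realizable if it has exactly one realizer of cardinality at most two (equivalently exactly two bichains $B$, namely some $B$ and $B^t$, satisfy $o(B)=P$). Embedding means isomorphism onto an induced substructure. -}

module Defs where

open import Data.Product using (Σ; _×_; _,_)
open import Data.Sum using (_⊎_)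
open import Function.Bundles using (_⇔_)
open import Function.Definitions using (Injective)
open import Relation.Binary.Core using (Rel)
open import Relation.Binary.Structures using (IsPartialOrder; IsTotalOrder)
open import Relation.Binary.PropositionalEquality using (_≡_)

record Poset : Set₁ where
  field
    Carrier : Set
    _≤_     : Rel Carrier _
    isPartialOrder : IsPartialOrder _≡_ _≤_

IsLinearOrder : {V : Set} → Rel V _ → Set
IsLinearOrder _≤_ = IsTotalOrder _≡_ _≤_

record Bichain (V : Set) : Set₁ where
  field
    _≤₁_ : Rel V _
    _≤₂_ : Rel V _
    linear₁ : IsLinearOrder _≤₁_
    linear₂ : IsLinearOrder _≤₂_

_ᵗ : {V : Set} → Bichain V → Bichain V
B ᵗ = record
  { _≤₁_ = _≤₂_
  ; _≤₂_ = _≤₁_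
  ; linear₁ = linear₂
  ; linear₂ = linear₁
  }
  where open Bichain B

_≐_ : {V : Set} → Rel V _ → Rel V _ → Set
R ≐ S = ∀ x y → R x y ⇔ S x y

IsRealizer₂ : (P : Poset) → Rel (Poset.Carrier P) _ → Rel (Poset.Carrier P) _ → Set
IsRealizer₂ P L₁ L₂ =
  IsLinearOrder L₁ × IsLinearOrder L₂ ×
  (∀ x y → Poset._≤_ P x y ⇔ (L₁ x y × L₂ x y))

-- P is uniquely realizable: P has exactly one realizer of cardinality at
-- most two, i.e. a realizer {L₁, L₂} exists and every realizer {M₁, M₂}
-- of cardinality at most two is the same set {L₁, L₂}.
UniquelyRealizable : Poset → Set₁
UniquelyRealizable P =
  Σ (Rel V _) λ L₁ → Σ (Rel V _) λ L₂ →
    IsRealizer₂ P L₁ L₂ ×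
    (∀ (M₁ M₂ : Rel V _) → IsRealizer₂ P M₁ M₂ →
       ((M₁ ≐ L₁) × (M₂ ≐ L₂)) ⊎ ((M₁ ≐ L₂) × (M₂ ≐ L₁)))
  where V = Poset.Carrier P

o≡ : (P : Poset) → Bichain (Poset.Carrier P) → Set
o≡ P B = ∀ x y → Poset._≤_ P x y ⇔ (Bichain._≤₁_ B x y × Bichain._≤₂_ B x y)

PosetEmbedding : Poset → Poset → Set
PosetEmbedding P Q =
  Σ (Poset.Carrier P → Poset.Carrier Q) λ f →
    Injective _≡_ _≡_ f ×
    (∀ x y → Poset._≤_ P x y ⇔ Poset._≤_ Q (f x) (f y))

BichainEmbedding : {V W : Set} → Bichain V → Bichain W → Set
BichainEmbedding {V} {W} B C =
  Σ (V → W) λ f →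
    Injective _≡_ _≡_ f ×
    (∀ x y → Bichain._≤₁_ B x y ⇔ Bichain._≤₁_ C (f x) (f y)) ×
    (∀ x y → Bichain._≤₂_ B x y ⇔ Bichain._≤₂_ C (f x) (f y))

-- An embedding f : P → P' pulls the two linear orders of B_{P'} back to a
-- two-element realizer of P. By unique realizability this realizer is the
-- one given by B_P, up to swapping its two orders; so f itself is a bichain
-- embedding of B_P into B_{P'} or into its transpose. Conversely a bichain
-- embedding preserves and reflects both orders, hence their intersection.
module Submission where

open import Defs
open import Data.Product using (_×_; _,_; swap)
open import Data.Product.Function.NonDependent.Propositional using (_×-⇔_)
open import Data.Sum as Sum using (_⊎_; inj₁; inj₂)
open import Function.Bundles using (_⇔_; mk⇔)
open import Function.Definitions using (Injective)
open import Function.Properties.Equivalence using (⇔-isEquivalence)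
open import Relation.Binary.Core using (Rel)
open import Relation.Binary.Structures using (IsEquivalence; IsTotalOrder)
open import Relation.Binary.PropositionalEquality using (_≡_; refl; isEquivalence)

private
  module ⇔ {ℓ} = IsEquivalence (⇔-isEquivalence {ℓ})

  variable
    V W : Set

≐-sym : {R S : Rel V _} → R ≐ S → S ≐ R
≐-sym R≐S x y = ⇔.sym (R≐S x y)

≐-trans : {R S T : Rel V _} → R ≐ S → S ≐ T → R ≐ T
≐-trans R≐S S≐T x y = ⇔.trans (R≐S x y) (S≐T x y)

IsLinearOrder-pullback : (f : V → W) → Injective _≡_ _≡_ f →
  {R : Rel W _} → IsLinearOrder R → IsLinearOrder (λ x y → R (f x) (f y))
IsLinearOrder-pullback f f-injective linear = record
  { isPartialOrder = record
    { isPreorder = record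
      { isEquivalence = isEquivalence
      ; reflexive = λ { refl → R-refl }
      ; trans = trans
      }
    ; antisym = λ x≤y y≤x → f-injective (antisym x≤y y≤x)
    }
  ; total = λ x y → total (f x) (f y)
  }
  where open IsTotalOrder linear renaming (refl to R-refl) using (trans; antisym; total)

pullback : (f : V → W) → Injective _≡_ _≡_ f → Bichain W → Bichain V
pullback f f-injective C = record
  { _≤₁_ = λ x y → f x ≤₁ f y
  ; _≤₂_ = λ x y → f x ≤₂ f y
  ; linear₁ = IsLinearOrder-pullback f f-injective linear₁
  ; linear₂ = IsLinearOrder-pullback f f-injective linear₂
  }
  where open Bichain C

EqualUpToSwap : (M₁ M₂ N₁ N₂ : Rel V _) → Set
EqualUpToSwap M₁ M₂ N₁ N₂ = ((M₁ ≐ N₁) × (M₂ ≐ N₂)) ⊎ ((M₁ ≐ N₂) × (M₂ ≐ N₁))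

EqualUpToSwap-through : {M₁ M₂ N₁ N₂ L₁ L₂ : Rel V _} →
  EqualUpToSwap M₁ M₂ L₁ L₂ → EqualUpToSwap N₁ N₂ L₁ L₂ → EqualUpToSwap M₁ M₂ N₁ N₂
EqualUpToSwap-through (inj₁ (m₁ , m₂)) (inj₁ (n₁ , n₂)) = inj₁ (≐-trans m₁ (≐-sym n₁) , ≐-trans m₂ (≐-sym n₂))
EqualUpToSwap-through (inj₁ (m₁ , m₂)) (inj₂ (n₁ , n₂)) = inj₂ (≐-trans m₁ (≐-sym n₂) , ≐-trans m₂ (≐-sym n₁))
EqualUpToSwap-through (inj₂ (m₁ , m₂)) (inj₁ (n₁ , n₂)) = inj₂ (≐-trans m₁ (≐-sym n₂) , ≐-trans m₂ (≐-sym n₁))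
EqualUpToSwap-through (inj₂ (m₁ , m₂)) (inj₂ (n₁ , n₂)) = inj₁ (≐-trans m₁ (≐-sym n₁) , ≐-trans m₂ (≐-sym n₂))

o≡-ᵗ : (P : Poset) (B : Bichain (Poset.Carrier P)) → o≡ P B → o≡ P (B ᵗ)
o≡-ᵗ P B oB x y = ⇔.trans (oB x y) (mk⇔ swap swap)

o≡-realizer : (P : Poset) (B : Bichain (Poset.Carrier P)) →
  o≡ P B → IsRealizer₂ P (Bichain._≤₁_ B) (Bichain._≤₂_ B)
o≡-realizer P B oB = Bichain.linear₁ B , Bichain.linear₂ B , oB

o≡-pullback : (P P' : Poset) ((f , f-injective , _) : PosetEmbedding P P') →
  (C : Bichain (Poset.Carrier P')) → o≡ P' C → o≡ P (pullback f f-injective C)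
o≡-pullback P P' (f , _ , f-embeds) C oC x y = ⇔.trans (f-embeds x y) (oC (f x) (f y))

o≡-unique : (P : Poset) → UniquelyRealizable P →
  (B C : Bichain (Poset.Carrier P)) → o≡ P B → o≡ P C →
  EqualUpToSwap (Bichain._≤₁_ B) (Bichain._≤₂_ B) (Bichain._≤₁_ C) (Bichain._≤₂_ C)
o≡-unique P (_ , _ , _ , unique) B C oB oC =
  EqualUpToSwap-through (unique _ _ (o≡-realizer P B oB)) (unique _ _ (o≡-realizer P C oC))

BichainEmbedding⇒PosetEmbedding : (P P' : Poset)
  (B : Bichain (Poset.Carrier P)) (C : Bichain (Poset.Carrier P')) →
  o≡ P B → o≡ P' C → BichainEmbedding B C → PosetEmbedding P P'
BichainEmbedding⇒PosetEmbedding P P' B C oB oC (f , f-injective , f-embeds₁ , f-embeds₂) =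
  f , f-injective , λ x y →
    ⇔.trans (oB x y) (⇔.trans (f-embeds₁ x y ×-⇔ f-embeds₂ x y) (⇔.sym (oC (f x) (f y))))

mainTheorem10 : (P P' : Poset) → UniquelyRealizable P →
    (BP : Bichain (Poset.Carrier P)) → (BP' : Bichain (Poset.Carrier P')) →
    o≡ P BP → o≡ P' BP' →
    PosetEmbedding P P' ⇔ (BichainEmbedding BP BP' ⊎ BichainEmbedding BP (BP' ᵗ))
mainTheorem10 P P' unique BP BP' oP oP' = mk⇔ forward backward
  where
  forward : PosetEmbedding P P' → BichainEmbedding BP BP' ⊎ BichainEmbedding BP (BP' ᵗ)
  -- Agreement of BP with the pullback of BP' (or its swap) is, by unfolding,
  -- exactly the order-reflection part of a bichain embedding into BP' (or BP' ᵗ).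
  forward embedding@(f , f-injective , _) =
    Sum.map (λ same → f , f-injective , same) (λ same → f , f-injective , same)
      (o≡-unique P unique BP (pullback f f-injective BP') oP (o≡-pullback P P' embedding BP' oP'))

  backward : BichainEmbedding BP BP' ⊎ BichainEmbedding BP (BP' ᵗ) → PosetEmbedding P P'
  backward (inj₁ embedding) = BichainEmbedding⇒PosetEmbedding P P' BP BP' oP oP' embedding
  backward (inj₂ embedding) =
    BichainEmbedding⇒PosetEmbedding P P' BP (BP' ᵗ) oP (o≡-ᵗ P' BP' oP') embedding
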